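{- Let $T$ be a string of length $n\ge 3$, and let $R(T)$ be the set of right-maximal substrings of $T$ (including $\varepsilon$ and all suffixes of $T$). Let $Q(T)$ be the set of quasi right-maximal substrings of $T$. Then the linear-size suffix trie $\mathsf{LST}(T)$ has at most $3n-3$ nodes, i.e. $|R(T)\cup Q(T)|\le 3n-3$, and at most $3n-4$ edges.
   Context: A substring $u$ of $T$ is right-maximal if $u$ is a suffix of $T$, or if $ua,ub$ are substrings of $T$ for two distinct characters $a,b$. For a character $c$ and a non-empty string $u$, the string $cu$ is quasi right-maximal in $T$ if $u$ is right-maximal in $T$, $cu$ is a substring of $T$, and $cu$ is not right-maximal in $T$. $\mathsf{LST}(T)$ is the rooted tree whose node set is $R(T)\cup Q(T)$. Type-1 nodes are the elements of $R(T)$ and type-2 nodes are the elements of $Q(T)$. The parent of a non-root node $w$ is the node that is the longest proper prefix of $w$ in this set. The edge $(u,v)$ is labelled by the character $v[|u|+1]$, together with a bit $+$ if $|v|-|u|>1$. -}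

module Defs where

open import Data.List using (List; []; _∷_; _++_; [_])
open import Data.Product using (Σ; ∃; ∃-syntax; _×_)
open import Data.Sum using (_⊎_)
open import Relation.Nullary using (¬_)
open import Relation.Binary.PropositionalEquality using (_≡_; _≢_)

module _ {A : Set} where

  Substring : List A → List A → Set
  Substring u T = ∃[ x ] ∃[ y ] (x ++ u ++ y ≡ T)

  Suffix : List A → List A → Set
  Suffix u T = ∃[ x ] (x ++ u ≡ T)

  Prefix : List A → List A → Set
  Prefix u v = ∃[ x ] (u ++ x ≡ v)

  ProperPrefix : List A → List A → Set
  ProperPrefix u v = ∃[ x ] (x ≢ [] × u ++ x ≡ v)

  RightMaximal : List A → List A → Set
  RightMaximal T u =
    Suffix u T ⊎
    (∃[ a ] ∃[ b ] (a ≢ b × Substring (u ++ [ a ]) T × Substring (u ++ [ b ]) T))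

  QuasiRightMaximal : List A → List A → Set
  QuasiRightMaximal T w =
    ∃[ c ] ∃[ u ] (w ≡ c ∷ u × u ≢ [] × RightMaximal T u
                   × Substring (c ∷ u) T × ¬ RightMaximal T (c ∷ u))

  LSTNode : List A → List A → Set
  LSTNode T w = RightMaximal T w ⊎ QuasiRightMaximal T w

  -- (u , v) is an edge of LST(T): u is the parent of the node v, i.e. the
  -- longest proper prefix of v that is a node (every node that is a proper
  -- prefix of v is a prefix of u).
  LSTEdge : List A → List A → List A → Set
  LSTEdge T u v =
    LSTNode T u × LSTNode T v × ProperPrefix u v ×
    (∀ w → LSTNode T w → ProperPrefix w v → Prefix w u)

-- A right-maximal u that is not a suffix of T is charged to the shortest suffix c ∷ S of T in
-- which it is right-maximal: then u ++ [ a ] is a prefix of c ∷ S and u ++ [ b ] occurs in S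
-- for some a ≢ b, and if two strings were charged to the same S the shorter would already be
-- right-maximal in S. As 2 ≤ |S| < n = |T|, there are at most (n + 1) + (n - 2) right-maximal
-- strings. A quasi right-maximal string is determined by the end, in [2, n), of any of its
-- occurrences: of two distinct ones ending there, the shorter would be a suffix of the
-- right-maximal tail of the longer, hence right-maximal itself. Every non-root node has exactly
-- one parent, so there are fewer edges than nodes.
module Submission where

open import Data.Fin as Fin using (Fin; fromℕ<; join; splitAt)
open import Data.Fin.Properties using (injective⇒≤; fromℕ<-injective; splitAt-join)
open import Data.List as List using (List; []; _∷_; _++_; [_]; length; lookup; map)
open import Data.List.Properties
  using (++-assoc; ++-identityʳ; ++-conicalˡ; ++-conicalʳ; ∷-injective; ∷-injectiveʳ; ∷ʳ-injectiveʳ;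
         length-++; length-++-≤ˡ; length-++-≤ʳ; length-map)
open import Data.List.Membership.Propositional.Properties using (∈-lookup)
open import Data.List.Relation.Unary.All as All using (All; []; _∷_)
open import Data.List.Relation.Unary.All.Properties using (map⁺)
open import Data.List.Relation.Unary.AllPairs using ([]; _∷_)
open import Data.List.Relation.Unary.Unique.Propositional using (Unique)
open import Data.Nat using (ℕ; suc; _+_; _*_; _∸_; _≤_; _<_; _≤?_; z≤n; s≤s)
open import Data.Nat.Properties
open import Data.Nat.Tactic.RingSolver using (solve)
open import Data.Product using (∃-syntax; _×_; _,_; proj₁; proj₂; uncurry; map₁; map₂)
open import Data.Sum as Sum using (_⊎_; inj₁; inj₂)
open import Data.Sum.Properties using (inj₁-injective; inj₂-injective)
open import Function using (_∘_)
open import Level using (0ℓ)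
open import Relation.Binary.Definitions using (tri<; tri≈; tri>)
open import Relation.Binary.PropositionalEquality hiding ([_])
open import Relation.Nullary using (¬_; yes; no; contradiction)
open import Relation.Nullary.Decidable using (decidable-stable; ¬¬-excluded-middle)
open import Relation.Nullary.Negation using (¬¬-map; ¬¬-Monad)

open import Defs

private
  variable
    A X Y : Set
    c : A
    u v w S T : List A

lookup-injective : {xs : List X} → Unique xs → ∀ i j → lookup xs i ≡ lookup xs j → i ≡ j
lookup-injective (_ ∷ _) Fin.zero Fin.zero _ = refl
lookup-injective (x∉xs ∷ _) Fin.zero (Fin.suc j) eq =
  contradiction eq (All.lookup x∉xs (∈-lookup j))
lookup-injective (x∉xs ∷ _) (Fin.suc i) Fin.zero eq =
  contradiction (sym eq) (All.lookup x∉xs (∈-lookup i))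
lookup-injective (_ ∷ xs!) (Fin.suc i) (Fin.suc j) eq = cong Fin.suc (lookup-injective xs! i j eq)

length≤-injectiveCode : {P : X → Set} {m : ℕ} (code : ∀ {x} → P x → Fin m) →
  (∀ {x y} (p : P x) (q : P y) → code p ≡ code q → x ≡ y) →
  ∀ {xs} → Unique xs → All P xs → length xs ≤ m
length≤-injectiveCode {m = m} code code-injective {xs} xs! pxs =
  injective⇒≤ {f = codeAt} codeAt-injective
  where
  codeAt : Fin (length xs) → Fin m
  codeAt i = code (All.lookup pxs (∈-lookup i))

  codeAt-injective : ∀ {i j} → codeAt i ≡ codeAt j → i ≡ j
  codeAt-injective {i} {j} eq = lookup-injective xs! i j (code-injective _ _ eq)

Unique-map⁺ : {P : X → Set} {f : X → Y} → (∀ {x y} → P x → P y → f x ≡ f y → x ≡ y) →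
  ∀ {xs} → All P xs → Unique xs → Unique (map f xs)
Unique-map⁺ f-injective [] [] = []
Unique-map⁺ {f = f} f-injective (px ∷ pxs) (x∉xs ∷ xs!) =
  map⁺ (All.zipWith (λ (py , x≢y) → x≢y ∘ f-injective px py) (pxs , x∉xs))
  ∷ Unique-map⁺ f-injective pxs xs!

-- Kept opaque so that rangeCode-injective can recover m and m′ from the codes by unification.
opaque
  rangeCode : ∀ {lo hi} m → lo ≤ m → m < hi → Fin (hi ∸ lo)
  rangeCode m lo≤m m<hi = fromℕ< (∸-monoˡ-< m<hi lo≤m)

  rangeCode-injective : ∀ {lo hi m m′} {lo≤m : lo ≤ m} {m<hi : m < hi}
    {lo≤m′ : lo ≤ m′} {m′<hi : m′ < hi} →
    rangeCode m lo≤m m<hi ≡ rangeCode m′ lo≤m′ m′<hi → m ≡ m′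
  rangeCode-injective {lo} {m = m} {m′} {lo≤m} {lo≤m′ = lo≤m′} eq =
    ∸-cancelʳ-≡ lo≤m lo≤m′ (fromℕ<-injective (m ∸ lo) (m′ ∸ lo) _ _ eq)

join₃ : ∀ k l m → Fin k ⊎ Fin l ⊎ Fin m → Fin (k + (l + m))
join₃ k l m = join k (l + m) ∘ Sum.map₂ (join l m)

join₃-injective : ∀ k l m {i j} → join₃ k l m i ≡ join₃ k l m j → i ≡ j
join₃-injective k l m {i} {j} eq =
  trans (sym (split₃-join₃ i)) (trans (cong split₃ eq) (split₃-join₃ j))
  where
  split₃ : Fin (k + (l + m)) → Fin k ⊎ Fin l ⊎ Fin m
  split₃ = Sum.map₂ (splitAt l) ∘ splitAt k

  split₃-join₃ : ∀ i → split₃ (join₃ k l m i) ≡ i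
  split₃-join₃ (inj₁ x) = cong (Sum.map₂ (splitAt l)) (splitAt-join k (l + m) (inj₁ x))
  split₃-join₃ (inj₂ y) =
    trans (cong (Sum.map₂ (splitAt l)) (splitAt-join k (l + m) (inj₂ (join l m y))))
          (cong inj₂ (splitAt-join l m y))

++-≡-++ : ∀ (ws xs ys zs : List A) → ws ++ xs ≡ ys ++ zs →
  (∃[ ds ] ws ≡ ys ++ ds × zs ≡ ds ++ xs) ⊎ (∃[ ds ] ys ≡ ws ++ ds × xs ≡ ds ++ zs)
++-≡-++ [] xs ys zs eq = inj₂ (ys , refl , eq)
++-≡-++ (w ∷ ws) xs [] zs eq = inj₁ (w ∷ ws , refl , sym eq)
++-≡-++ (w ∷ ws) xs (y ∷ ys) zs eq with refl , eq′ ← ∷-injective eq =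
  Sum.map (map₂ (map₁ (cong (w ∷_)))) (map₂ (map₁ (cong (w ∷_)))) (++-≡-++ ws xs ys zs eq′)

length-∷ʳ : ∀ (u : List A) a → length (u ++ [ a ]) ≡ suc (length u)
length-∷ʳ [] a = refl
length-∷ʳ (_ ∷ u) a = cong suc (length-∷ʳ u a)

Prefix-length : Prefix u v → length u ≤ length v
Prefix-length {u = u} (_ , refl) = length-++-≤ˡ u

Prefix-trans : Prefix u v → Prefix v w → Prefix u w
Prefix-trans {u = u} (xs , refl) (ys , refl) = xs ++ ys , sym (++-assoc u xs ys)

Prefix-length-≡ : Prefix u v → length u ≡ length v → u ≡ v
Prefix-length-≡ {u = u} ([] , refl) _ = sym (++-identityʳ u)
Prefix-length-≡ {u = u} (_ ∷ _ , refl) eq =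
  contradiction (trans (sym (length-++ u)) (sym eq)) (m+1+n≢m (length u))

Prefix-antisym : Prefix u v → Prefix v u → u ≡ v
Prefix-antisym u⊑v v⊑u =
  Prefix-length-≡ u⊑v (≤-antisym (Prefix-length u⊑v) (Prefix-length v⊑u))

prefix-by-length : Prefix u w → Prefix v w → length u ≤ length v → Prefix u v
prefix-by-length {u = u} {v = v} (xs , refl) (ys , eq) u≤v with ++-≡-++ u xs v ys (sym eq)
... | inj₁ (ds , u≡v++ds , _) = [] , trans (++-identityʳ u) (sym v≡u)
  where
  v⊑u : Prefix v u
  v⊑u = ds , sym u≡v++ds

  v≡u : v ≡ u
  v≡u = Prefix-length-≡ v⊑u (≤-antisym (Prefix-length v⊑u) u≤v)
... | inj₂ (ds , v≡u++ds , _) = ds , sym v≡u++ds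

prefix-unique : Prefix u w → Prefix v w → length u ≡ length v → u ≡ v
prefix-unique u⊑w v⊑w eq = Prefix-length-≡ (prefix-by-length u⊑w v⊑w (≤-reflexive eq)) eq

ProperPrefix-length : ProperPrefix u v → length u < length v
ProperPrefix-length ([] , xs≢[] , _) = contradiction refl xs≢[]
ProperPrefix-length {u = u} (_ ∷ _ , _ , refl) =
  subst (length u <_) (sym (length-++ u)) (m<m+n (length u) (s≤s z≤n))

Suffix-[] : ∀ (v : List A) → Suffix [] v
Suffix-[] v = v , ++-identityʳ v

Suffix-length : Suffix u v → length u ≤ length v
Suffix-length {u = u} (xs , refl) = length-++-≤ʳ u {xs}

Suffix-trans : Suffix u v → Suffix v w → Suffix u w
Suffix-trans {u = u} (xs , refl) (ys , refl) = ys ++ xs , ++-assoc ys xs u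

Suffix-++ʳ : Suffix u v → Suffix (u ++ w) (v ++ w)
Suffix-++ʳ {u = u} {w = w} (xs , refl) = xs , sym (++-assoc xs u w)

Suffix-length-≡ : Suffix u v → length u ≡ length v → u ≡ v
Suffix-length-≡ ([] , refl) _ = refl
Suffix-length-≡ {u = u} (_ ∷ xs , refl) eq =
  contradiction (trans eq (cong suc (length-++ xs))) (m≢1+n+m (length u))

suffix-by-length : Suffix u w → Suffix v w → length u ≤ length v → Suffix u v
suffix-by-length {u = u} {v = v} (xs , eq) (ys , refl) u≤v with ++-≡-++ xs u ys v eq
... | inj₁ (ds , _ , v≡ds++u) = ds , sym v≡ds++u
... | inj₂ (ds , _ , u≡ds++v) = [] , sym (Suffix-length-≡ v⊒u (≤-antisym (Suffix-length v⊒u) u≤v))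
  where
  v⊒u : Suffix v u
  v⊒u = ds , sym u≡ds++v

suffix-unique : Suffix u w → Suffix v w → length u ≡ length v → u ≡ v
suffix-unique u⊒w v⊒w eq = Suffix-length-≡ (suffix-by-length u⊒w v⊒w (≤-reflexive eq)) eq

suffixes-comparable : Suffix u w → Suffix v w → Suffix u v ⊎ Suffix v u
suffixes-comparable {u = u} {v = v} u⊒w v⊒w with ≤-total (length u) (length v)
... | inj₁ u≤v = inj₁ (suffix-by-length u⊒w v⊒w u≤v)
... | inj₂ v≤u = inj₂ (suffix-by-length v⊒w u⊒w v≤u)

Substring-trans : Substring u v → Substring v w → Substring u w
Substring-trans {u = u} (xs , ys , refl) (xs′ , ys′ , refl) = xs′ ++ xs , ys ++ ys′ , (begin
  (xs′ ++ xs) ++ u ++ ys ++ ys′   ≡⟨ ++-assoc xs′ xs _ ⟩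
  xs′ ++ xs ++ u ++ ys ++ ys′     ≡⟨ cong (λ zs → xs′ ++ xs ++ zs) (++-assoc u ys ys′) ⟨
  xs′ ++ xs ++ (u ++ ys) ++ ys′   ≡⟨ cong (xs′ ++_) (++-assoc xs (u ++ ys) ys′) ⟨
  xs′ ++ (xs ++ u ++ ys) ++ ys′   ∎)
  where open ≡-Reasoning

Prefix⇒Substring : Prefix u v → Substring u v
Prefix⇒Substring (xs , eq) = [] , xs , eq

Suffix⇒Substring : Suffix u v → Substring u v
Suffix⇒Substring {u = u} (xs , eq) = xs , [] , trans (cong (xs ++_) (++-identityʳ u)) eq

Substring-length : Substring u v → length u ≤ length v
Substring-length {u = u} (xs , ys , refl) =
  ≤-trans (length-++-≤ˡ u) (length-++-≤ʳ (u ++ ys) {xs})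

Substring-[] : Substring u [] → u ≡ []
Substring-[] {u = u} (xs , ys , eq) = ++-conicalˡ u ys (++-conicalʳ xs _ eq)

Substring-∷ : Substring u (c ∷ v) → Prefix u (c ∷ v) ⊎ Substring u v
Substring-∷ ([] , ys , eq) = inj₁ (ys , eq)
Substring-∷ (_ ∷ xs , ys , eq) = inj₂ (xs , ys , ∷-injectiveʳ eq)

RightMaximal⇒Substring : RightMaximal T u → Substring u T
RightMaximal⇒Substring (inj₁ u⊒T) = Suffix⇒Substring u⊒T
RightMaximal⇒Substring (inj₂ (a , _ , _ , ua∈T , _)) =
  Substring-trans (Prefix⇒Substring ([ a ] , refl)) ua∈T

RightMaximal-suffix : Suffix u v → RightMaximal T v → RightMaximal T u
RightMaximal-suffix u⊒v (inj₁ v⊒T) = inj₁ (Suffix-trans u⊒v v⊒T)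
RightMaximal-suffix u⊒v (inj₂ (a , b , a≢b , va∈T , vb∈T)) =
  inj₂ (a , b , a≢b , Substring-trans (Suffix⇒Substring (Suffix-++ʳ u⊒v)) va∈T
                    , Substring-trans (Suffix⇒Substring (Suffix-++ʳ u⊒v)) vb∈T)

-- u becomes right-maximal, without being a suffix, when c is prepended to S.
record NewBranchAt (c : A) (S u : List A) : Set where
  constructor newBranchAt
  field
    a b : A
    a≢b : a ≢ b
    atStart : Prefix (u ++ [ a ]) (c ∷ S)
    inTail : Substring (u ++ [ b ]) S
    ¬rightMaximal : ¬ RightMaximal S u

NewBranch : List A → List A → Set
NewBranch T u = ∃[ c ] ∃[ S ] Suffix (c ∷ S) T × NewBranchAt c S u

NewBranchAt-length : NewBranchAt c S u → 2 ≤ length S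
NewBranchAt-length {S = S} {u = []} nb =
  contradiction (inj₁ (Suffix-[] S)) (NewBranchAt.¬rightMaximal nb)
NewBranchAt-length {u = _ ∷ u} (newBranchAt _ b _ _ ub∈S _) =
  ≤-trans (s≤s (length-++-≤ʳ [ b ] {u})) (Substring-length ub∈S)

NewBranchAt-¬< : NewBranchAt c S u → NewBranchAt c S v → ¬ (length u < length v)
NewBranchAt-¬< {S = S} {u = u} {v = v} (newBranchAt a _ a≢b ua⊑cS ub∈S ¬rmS)
                                       (newBranchAt a′ b′ _ va′⊑cS vb′∈S _) u<v =
  ¬rmS (inj₂ (_ , _ , a≢b , ua∈S , ub∈S))
  where
  ua⊑v : Prefix (u ++ [ a ]) v
  ua⊑v = prefix-by-length ua⊑cS (Prefix-trans ([ a′ ] , refl) va′⊑cS)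
                          (subst (_≤ length v) (sym (length-∷ʳ u a)) u<v)

  ua∈S : Substring (u ++ [ a ]) S
  ua∈S = Substring-trans (Prefix⇒Substring (Prefix-trans ua⊑v ([ b′ ] , refl))) vb′∈S

NewBranchAt-unique : NewBranchAt c S u → NewBranchAt c S v → u ≡ v
NewBranchAt-unique {u = u} {v = v} nb nb′ with <-cmp (length u) (length v)
... | tri< u<v _ _ = contradiction u<v (NewBranchAt-¬< nb nb′)
... | tri> _ _ v<u = contradiction v<u (NewBranchAt-¬< nb′ nb)
... | tri≈ _ u≡v _ = prefix-unique (Prefix-trans (_ , refl) (NewBranchAt.atStart nb))
                                   (Prefix-trans (_ , refl) (NewBranchAt.atStart nb′)) u≡v

rightMaximal-extension : Suffix (c ∷ S) T → RightMaximal (c ∷ S) u → ¬ RightMaximal S u →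
  Suffix u T ⊎ NewBranch T u
rightMaximal-extension cS⊒T (inj₁ ([] , refl)) _ = inj₁ cS⊒T
rightMaximal-extension _ (inj₁ (_ ∷ xs , eq)) ¬rmS = contradiction (inj₁ (xs , ∷-injectiveʳ eq)) ¬rmS
rightMaximal-extension {u = u} cS⊒T (inj₂ (a , b , a≢b , ua∈cS , ub∈cS)) ¬rmS
  with Substring-∷ ua∈cS | Substring-∷ ub∈cS
... | inj₁ ua⊑cS | inj₁ ub⊑cS = contradiction (∷ʳ-injectiveʳ u u ua≡ub) a≢b
  where
  ua≡ub : u ++ [ a ] ≡ u ++ [ b ]
  ua≡ub = prefix-unique ua⊑cS ub⊑cS (trans (length-∷ʳ u a) (sym (length-∷ʳ u b)))
... | inj₁ ua⊑cS | inj₂ ub∈S = inj₂ (_ , _ , cS⊒T , newBranchAt a b a≢b ua⊑cS ub∈S ¬rmS)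
... | inj₂ ua∈S | inj₁ ub⊑cS = inj₂ (_ , _ , cS⊒T , newBranchAt b a (a≢b ∘ sym) ub⊑cS ua∈S ¬rmS)
... | inj₂ ua∈S | inj₂ ub∈S = contradiction (inj₂ (a , b , a≢b , ua∈S , ub∈S)) ¬rmS

-- Right-maximality is undecidable over an arbitrary alphabet, so the shortest suffix of T in
-- which u stays right-maximal is only found under double negation.
rightMaximal-classify : ∀ S → Suffix S T → RightMaximal S u → ¬ ¬ (Suffix u T ⊎ NewBranch T u)
rightMaximal-classify {T = T} [] _ rm with refl ← Substring-[] (RightMaximal⇒Substring rm) =
  λ k → k (inj₁ (Suffix-[] T))
rightMaximal-classify (c ∷ S) cS⊒T rm k = ¬¬-excluded-middle λ where
  (yes rmS) → rightMaximal-classify S (Suffix-trans ([ c ] , refl) cS⊒T) rmS k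
  (no ¬rmS) → k (rightMaximal-extension cS⊒T rm ¬rmS)

quasiEnd : QuasiRightMaximal T w → ℕ
quasiEnd (c , u , _ , _ , _ , (xs , _ , _) , _) = length (xs ++ c ∷ u)

quasiEnd-≥2 : (q : QuasiRightMaximal T w) → 2 ≤ quasiEnd q
quasiEnd-≥2 (_ , [] , _ , u≢[] , _) = contradiction refl u≢[]
quasiEnd-≥2 (c , d ∷ u , _ , _ , _ , (xs , _ , _) , _) =
  ≤-trans (s≤s (s≤s z≤n)) (length-++-≤ʳ (c ∷ d ∷ u) {xs})

quasiEnd-< : (q : QuasiRightMaximal T w) → quasiEnd q < length T
quasiEnd-< (c , u , _ , _ , _ , (xs , [] , eq) , ¬rm) =
  contradiction (inj₁ (xs , trans (cong (xs ++_) (sym (++-identityʳ (c ∷ u)))) eq)) ¬rm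
quasiEnd-< (c , u , _ , _ , _ , (xs , d ∷ ys , eq) , _) =
  ProperPrefix-length (d ∷ ys , (λ ()) , trans (++-assoc xs (c ∷ u) (d ∷ ys)) eq)

QuasiRightMaximal-suffix : QuasiRightMaximal T v → QuasiRightMaximal T w → Suffix v w → v ≡ w
QuasiRightMaximal-suffix _ _ ([] , eq) = eq
QuasiRightMaximal-suffix (_ , _ , refl , _ , _ , _ , ¬rm) (_ , _ , refl , _ , rm′ , _ , _)
                         (_ ∷ xs , eq) =
  contradiction (RightMaximal-suffix (xs , ∷-injectiveʳ eq) rm′) ¬rm

quasiEnd-injective : (q : QuasiRightMaximal T v) (q′ : QuasiRightMaximal T w) →
  quasiEnd q ≡ quasiEnd q′ → v ≡ w
quasiEnd-injective q@(c , u , refl , _ , _ , (xs , ys , eq) , _)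
                   q′@(c′ , u′ , refl , _ , _ , (xs′ , ys′ , eq′) , _) sameEnd =
  Sum.[ QuasiRightMaximal-suffix q q′ , sym ∘ QuasiRightMaximal-suffix q′ q ]′
    (suffixes-comparable (xs , refl) (xs′ , sym samePrefix))
  where
  samePrefix : xs ++ c ∷ u ≡ xs′ ++ c′ ∷ u′
  samePrefix = prefix-unique (ys , trans (++-assoc xs (c ∷ u) ys) eq)
                             (ys′ , trans (++-assoc xs′ (c′ ∷ u′) ys′) eq′) sameEnd

module _ {A : Set} (T : List A) where

  private
    n : ℕ
    n = length T

  NodeClass : List A → Set
  NodeClass w = Suffix w T ⊎ NewBranch T w ⊎ QuasiRightMaximal T w

  classify : ∀ {w} → LSTNode T w → ¬ ¬ NodeClass w
  classify (inj₁ rm) = ¬¬-map (Sum.map₂ inj₁) (rightMaximal-classify T ([] , refl) rm)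
  classify (inj₂ q) k = k (inj₂ (inj₂ q))

  nodeCode : ∀ {w} → NodeClass w → Fin (suc n) ⊎ Fin (n ∸ 2) ⊎ Fin (n ∸ 2)
  nodeCode (inj₁ w⊒T) = inj₁ (rangeCode _ z≤n (s≤s (Suffix-length w⊒T)))
  nodeCode (inj₂ (inj₁ (_ , S , cS⊒T , nb))) =
    inj₂ (inj₁ (rangeCode (length S) (NewBranchAt-length nb) (Suffix-length cS⊒T)))
  nodeCode (inj₂ (inj₂ q)) = inj₂ (inj₂ (rangeCode (quasiEnd q) (quasiEnd-≥2 q) (quasiEnd-< q)))

  nodeCode-injective : ∀ {w w′} (p : NodeClass w) (q : NodeClass w′) →
    nodeCode p ≡ nodeCode q → w ≡ w′
  nodeCode-injective (inj₁ w⊒T) (inj₁ w′⊒T) eq =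
    suffix-unique w⊒T w′⊒T (rangeCode-injective (inj₁-injective eq))
  nodeCode-injective (inj₂ (inj₁ (_ , _ , cS⊒T , nb))) (inj₂ (inj₁ (_ , _ , cS′⊒T , nb′))) eq
    with refl ← suffix-unique cS⊒T cS′⊒T
                  (cong suc (rangeCode-injective (inj₁-injective (inj₂-injective eq))))
    = NewBranchAt-unique nb nb′
  nodeCode-injective (inj₂ (inj₂ q)) (inj₂ (inj₂ q′)) eq =
    quasiEnd-injective q q′ (rangeCode-injective (inj₂-injective (inj₂-injective eq)))
  nodeCode-injective (inj₁ _) (inj₂ (inj₁ _)) ()
  nodeCode-injective (inj₁ _) (inj₂ (inj₂ _)) ()
  nodeCode-injective (inj₂ (inj₁ _)) (inj₁ _) ()
  nodeCode-injective (inj₂ (inj₂ _)) (inj₁ _) ()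
  nodeCode-injective (inj₂ (inj₁ _)) (inj₂ (inj₂ _)) ()
  nodeCode-injective (inj₂ (inj₂ _)) (inj₂ (inj₁ _)) ()

  nodeCount : ∀ {ns} → Unique ns → All (LSTNode T) ns →
    length ns ≤ suc n + ((n ∸ 2) + (n ∸ 2))
  nodeCount ns! nodes = decidable-stable (_ ≤? _)
    (¬¬-map (length≤-injectiveCode code code-injective ns!) (All.mapM 0ℓ ¬¬-Monad classify nodes))
    where
    code : ∀ {w} → NodeClass w → Fin (suc n + ((n ∸ 2) + (n ∸ 2)))
    code = join₃ _ _ _ ∘ nodeCode

    code-injective : ∀ {w w′} (p : NodeClass w) (q : NodeClass w′) →
      code p ≡ code q → w ≡ w′
    code-injective p q eq = nodeCode-injective p q (join₃-injective _ _ _ eq)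

  LSTEdge-child-injective : ∀ {e e′} → uncurry (LSTEdge T) e → uncurry (LSTEdge T) e′ →
    proj₂ e ≡ proj₂ e′ → e ≡ e′
  LSTEdge-child-injective {_ , _} {_ , _} (u-node , _ , u⊏v , u-parent)
                                          (u′-node , _ , u′⊏v , u′-parent) refl =
    cong (_, _) (Prefix-antisym (u′-parent _ u-node u⊏v) (u-parent _ u′-node u′⊏v))

  edgeCount : ∀ {m} → (∀ {ns} → Unique ns → All (LSTNode T) ns → length ns ≤ m) →
    ∀ {es} → Unique es → All (uncurry (LSTEdge T)) es → suc (length es) ≤ m
  edgeCount nodeBound {es} es! edges =
    subst (λ k → suc k ≤ _) (length-map proj₂ es) (nodeBound children! children-nodes)
    where
    root-not-child : ∀ {e} → uncurry (LSTEdge T) e → [] ≢ proj₂ e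
    root-not-child (_ , _ , u⊏v , _) refl = n≮0 (ProperPrefix-length u⊏v)

    children! : Unique ([] ∷ map proj₂ es)
    children! = map⁺ (All.map root-not-child edges) ∷ Unique-map⁺ LSTEdge-child-injective edges es!

    children-nodes : All (LSTNode T) ([] ∷ map proj₂ es)
    children-nodes = inj₁ (inj₁ (Suffix-[] T)) ∷ map⁺ (All.map (proj₁ ∘ proj₂) edges)

1+n+[n∸2]+[n∸2]≡3*n∸3 : ∀ n → 3 ≤ n → suc n + ((n ∸ 2) + (n ∸ 2)) ≡ 3 * n ∸ 3
1+n+[n∸2]+[n∸2]≡3*n∸3 (suc (suc (suc k))) _ = identity
  where
  identity : 4 + k + ((1 + k) + (1 + k)) ≡ k + 2 * (3 + k)
  identity = solve (k List.∷ List.[])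
1+n+[n∸2]+[n∸2]≡3*n∸3 (suc (suc 0)) (s≤s (s≤s ()))
1+n+[n∸2]+[n∸2]≡3*n∸3 (suc 0) (s≤s ())

lemma1 : {A : Set} (T : List A) → 3 ≤ length T →
    ((ns : List (List A)) → Unique ns → All (LSTNode T) ns →
       length ns ≤ 3 * length T ∸ 3)
    ×
    ((es : List (List A × List A)) → Unique es → All (uncurry (LSTEdge T)) es →
       length es ≤ 3 * length T ∸ 4)
lemma1 T 3≤n = nodeBound , edgeBound
  where
  nodeBound : ∀ ns → Unique ns → All (LSTNode T) ns → length ns ≤ 3 * length T ∸ 3
  nodeBound ns ns! nodes =
    subst (length ns ≤_) (1+n+[n∸2]+[n∸2]≡3*n∸3 (length T) 3≤n) (nodeCount T ns! nodes)

  edgeBound : ∀ es → Unique es → All (uncurry (LSTEdge T)) es → length es ≤ 3 * length T ∸ 4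
  edgeBound es es! edges =
    ≤-trans (∸-monoˡ-≤ 1 (edgeCount T (nodeBound _) es! edges))
            (≤-reflexive (∸-+-assoc (3 * length T) 3 1))
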